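{- The following sixteen mesh patterns $(12,R)$ are pairwise equidistributed, where $R$ ranges over: $\{(0,2),(1,2),(2,2),(0,1),(2,1)\}$, $\{(0,2),(1,2),(0,1),(0,0),(1,0)\}$, $\{(1,2),(2,2),(2,1),(1,0),(2,0)\}$, $\{(0,1),(2,1),(0,0),(1,0),(2,0)\}$, $\{(0,2),(1,2),(2,2),(1,1),(2,1)\}$, $\{(0,2),(0,1),(1,1),(0,0),(1,0)\}$, $\{(1,2),(2,2),(1,1),(2,1),(2,0)\}$, $\{(0,1),(1,1),(0,0),(1,0),(2,0)\}$, $\{(0,2),(2,2),(0,1),(2,1),(2,0)\}$, $\{(0,2),(0,1),(2,1),(0,0),(2,0)\}$, $\{(0,2),(1,2),(2,2),(1,0),(2,0)\}$, $\{(0,2),(1,2),(0,0),(1,0),(2,0)\}$, $\{(0,2),(1,2),(2,2),(0,0),(2,0)\}$, $\{(0,2),(2,2),(0,1),(0,0),(2,0)\}$, $\{(0,2),(2,2),(2,1),(0,0),(2,0)\}$, $\{(0,2),(2,2),(0,0),(1,0),(2,0)\}$. Moreover, for each such pattern $p$ and each $n\ge2$, exactly $n!/2$ permutations in $S_n$ avoid $p$.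
   Context: For $R\subseteq\{0,1,2\}^2$ and $\pi=\pi_1\cdots\pi_n\in S_n$, an occurrence of the mesh pattern $(12,R)$ in $\pi$ is a pair of positions $i_1<i_2$ with $\pi_{i_1}<\pi_{i_2}$ such that, setting $x_0=0,x_1=i_1,x_2=i_2,x_3=n+1$ and $y_0=0,y_1=\pi_{i_1},y_2=\pi_{i_2},y_3=n+1$, for every $(a,b)\in R$ there is no index $k$ with $x_a<k<x_{a+1}$ and $y_b<\pi_k<y_{b+1}$. A permutation avoids $p$ if it has no occurrence of $p$. $s_{n,k}(p)$ is the number of $\pi\in S_n$ with exactly $k$ occurrences of $p$; $p_1,p_2$ are equidistributed if $s_{n,k}(p_1)=s_{n,k}(p_2)$ for all $n,k\ge 0$. -}

module Defs where

open import Data.Bool using (Bool; true; false; _∧_; _∨_; not; if_then_else_)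
open import Data.Nat using (ℕ; zero; suc; _+_; _<ᵇ_; _≡ᵇ_)
open import Data.Fin using (Fin; toℕ)
open import Data.Fin.Patterns using (0F; 1F; 2F)
open import Data.List using (List; []; _∷_; map; concatMap; allFin)
open import Data.Bool.ListAction using (all; any)
open import Data.Vec using (Vec; lookup)
import Data.Vec
import Data.List
open import Data.Product using (_×_; _,_)

-- A mesh pattern (12,R) is given by its shaded set R ⊆ {0,1,2}², as a list of boxes (a,b).
MeshSet : Set
MeshSet = List (Fin 3 × Fin 3)

count : {A : Set} → (A → Bool) → List A → ℕ
count p []       = 0
count p (x ∷ xs) = if p x then suc (count p xs) else count p xs

allVecs : (m n : ℕ) → List (Vec (Fin n) m)
allVecs zero    n = Data.Vec.[] ∷ []
allVecs (suc m) n = concatMap (λ v → map (λ a → a Data.Vec.∷ v) (allFin n)) (allVecs m n)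

-- Position i ↦ i+1, value v ↦ v+1 gives the usual
-- one-line notation π₁⋯πₙ of an element of Sₙ.
isPerm : {n : ℕ} → Vec (Fin n) n → Bool
isPerm {n} π = all (λ i → all (λ j → (toℕ i ≡ᵇ toℕ j) ∨ not (toℕ (lookup π i) ≡ᵇ toℕ (lookup π j))) (allFin n)) (allFin n)

Sn : (n : ℕ) → List (Vec (Fin n) n)
Sn n = Data.List.filterᵇ isPerm (allVecs n n)

val : {n : ℕ} → Vec (Fin n) n → Fin n → ℕ
val π k = suc (toℕ (lookup π k))

-- x₀ = 0, x₁ = i₁, x₂ = i₂, x₃ = n+1 (lower/upper grid lines of column a)
lowC upC : ℕ → ℕ → ℕ → Fin 3 → ℕ
lowC n x1 x2 0F = 0
lowC n x1 x2 1F = x1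
lowC n x1 x2 2F = x2
upC  n x1 x2 0F = x1
upC  n x1 x2 1F = x2
upC  n x1 x2 2F = suc n

btw : ℕ → ℕ → ℕ → Bool
btw lo x hi = (lo <ᵇ x) ∧ (x <ᵇ hi)

isOcc : {n : ℕ} → MeshSet → Vec (Fin n) n → Fin n → Fin n → Bool
isOcc {n} R π i₁ i₂ =
  let x1 = suc (toℕ i₁) ; x2 = suc (toℕ i₂)
      y1 = val π i₁     ; y2 = val π i₂
  in (x1 <ᵇ x2) ∧ (y1 <ᵇ y2) ∧
     all (λ { (a , b) → not (any (λ k →
            btw (lowC n x1 x2 a) (suc (toℕ k)) (upC n x1 x2 a) ∧
            btw (lowC n y1 y2 b) (val π k)     (upC n y1 y2 b)) (allFin n)) }) R

occ : {n : ℕ} → MeshSet → Vec (Fin n) n → ℕ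
occ {n} R π = count (λ { (i₁ , i₂) → isOcc R π i₁ i₂ })
                    (concatMap (λ i → map (λ j → (i , j)) (allFin n)) (allFin n))

s : ℕ → ℕ → MeshSet → ℕ
s n k R = count (λ π → occ R π ≡ᵇ k) (Sn n)

pat : Fin 16 → MeshSet
pat i = Data.Vec.lookup table i
  where
  table : Vec MeshSet 16
  table =
    ((0F , 2F) ∷ (1F , 2F) ∷ (2F , 2F) ∷ (0F , 1F) ∷ (2F , 1F) ∷ []) Data.Vec.∷
    ((0F , 2F) ∷ (1F , 2F) ∷ (0F , 1F) ∷ (0F , 0F) ∷ (1F , 0F) ∷ []) Data.Vec.∷
    ((1F , 2F) ∷ (2F , 2F) ∷ (2F , 1F) ∷ (1F , 0F) ∷ (2F , 0F) ∷ []) Data.Vec.∷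
    ((0F , 1F) ∷ (2F , 1F) ∷ (0F , 0F) ∷ (1F , 0F) ∷ (2F , 0F) ∷ []) Data.Vec.∷
    ((0F , 2F) ∷ (1F , 2F) ∷ (2F , 2F) ∷ (1F , 1F) ∷ (2F , 1F) ∷ []) Data.Vec.∷
    ((0F , 2F) ∷ (0F , 1F) ∷ (1F , 1F) ∷ (0F , 0F) ∷ (1F , 0F) ∷ []) Data.Vec.∷
    ((1F , 2F) ∷ (2F , 2F) ∷ (1F , 1F) ∷ (2F , 1F) ∷ (2F , 0F) ∷ []) Data.Vec.∷
    ((0F , 1F) ∷ (1F , 1F) ∷ (0F , 0F) ∷ (1F , 0F) ∷ (2F , 0F) ∷ []) Data.Vec.∷
    ((0F , 2F) ∷ (2F , 2F) ∷ (0F , 1F) ∷ (2F , 1F) ∷ (2F , 0F) ∷ []) Data.Vec.∷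
    ((0F , 2F) ∷ (0F , 1F) ∷ (2F , 1F) ∷ (0F , 0F) ∷ (2F , 0F) ∷ []) Data.Vec.∷
    ((0F , 2F) ∷ (1F , 2F) ∷ (2F , 2F) ∷ (1F , 0F) ∷ (2F , 0F) ∷ []) Data.Vec.∷
    ((0F , 2F) ∷ (1F , 2F) ∷ (0F , 0F) ∷ (1F , 0F) ∷ (2F , 0F) ∷ []) Data.Vec.∷
    ((0F , 2F) ∷ (1F , 2F) ∷ (2F , 2F) ∷ (0F , 0F) ∷ (2F , 0F) ∷ []) Data.Vec.∷
    ((0F , 2F) ∷ (2F , 2F) ∷ (0F , 1F) ∷ (0F , 0F) ∷ (2F , 0F) ∷ []) Data.Vec.∷
    ((0F , 2F) ∷ (2F , 2F) ∷ (2F , 1F) ∷ (0F , 0F) ∷ (2F , 0F) ∷ []) Data.Vec.∷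
    ((0F , 2F) ∷ (2F , 2F) ∷ (0F , 0F) ∷ (1F , 0F) ∷ (2F , 0F) ∷ []) Data.Vec.∷
    Data.Vec.[]

{-# OPTIONS --safe #-}
-- Three involutions of Sₙ carry the occurrences of one mesh pattern (12,R) bijectively onto those of
-- another, so they preserve the distribution of the number of occurrences: the reverse-complement
-- turns the diagram of π, hence the shading R, by 180°; the inverse transposes it; and reversing
-- the prefix π₁⋯π_{m-1} swaps the two left columns of R, provided every occurrence (i, j) of either
-- pattern has j = m. That proviso holds when the top row of R is shaded (the point of value n would
-- lie in a shaded box unless πⱼ = n, so m is the position of n) or when the right column is shaded
-- (then j = n). These moves connect all sixteen patterns to pattern 8 = {(0,2),(2,2),(0,1),(2,1),(2,0)},
-- whose shaded right column forces j = n. If πₙ < π₁, the point (1, π₁) then lies in the shaded box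
-- (0,2) unless i = 1, where there is no ascent; if π₁ < πₙ, the pair (1, n) is an occurrence. So π
-- avoids pattern 8 iff πₙ < π₁, and reversal shows that this holds for exactly half of Sₙ.
module Submission where

open import Defs
open import Data.Bool using (Bool; true; false; T; not; _∧_; if_then_else_)
open import Data.Bool.ListAction using (all; any; and; or)
open import Data.Bool.Properties using (T-≡; T-∧; T-∨; T-not-≡; ∧-comm; ∧-assoc; ∧-zeroʳ; ∧-identityʳ)
open import Data.Empty using (⊥; ⊥-elim)
open import Data.Fin as Fin using (Fin; toℕ; fromℕ; opposite; punchOut)
open import Data.Fin.Patterns using (0F; 1F; 2F; 3F; 4F; 5F; 6F; 7F; 8F; 9F)
open import Data.Fin.Properties as Fin
  using ( _≟_; any?; toℕ-injective; toℕ-fromℕ; toℕ-fromℕ<; toℕ<n; opposite-prop; opposite-involutive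
        ; punchOut-injective; injective⇒≤)
open import Data.List
  using (List; []; _∷_; _++_; map; concatMap; length; allFin; filterᵇ; cartesianProduct; cartesianProductWith)
open import Data.List.Properties using (map-∘; map-cong; map-id-local; length-tabulate)
open import Data.List.Membership.Propositional using (_∈_; _∉_; lose)
open import Data.List.Membership.Propositional.Properties
  using (∈-allFin; ∈-map⁺; ∈-map⁻; ∈-filter⁺; ∈-filter⁻; ∈-cartesianProduct⁺; ∈-cartesianProductWith⁺)
open import Data.List.Membership.Propositional.Properties.WithK using (unique∧set⇒bag)
open import Data.List.Relation.Binary.BagAndSetEquality using (∼bag⇒↭)
open import Data.List.Relation.Binary.Permutation.Propositional as ↭ using (_↭_)
open import Data.List.Relation.Binary.Subset.Propositional using (_⊆_)
open import Data.List.Relation.Unary.All as All using ([]; _∷_)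
open import Data.List.Relation.Unary.All.Properties using (all⁺; all⁻; all-anti-mono; All¬⇒¬Any)
open import Data.List.Relation.Unary.AllPairs using ([]; _∷_)
open import Data.List.Relation.Unary.Any using (here; there; satisfied)
open import Data.List.Relation.Unary.Any.Properties using (any⁺; any⁻)
open import Data.List.Relation.Unary.Unique.Propositional using (Unique)
open import Data.List.Relation.Unary.Unique.Propositional.Properties as Unique
  using (allFin⁺; cartesianProduct⁺; cartesianProductWith⁺; filter⁺)
open import Data.Nat using (ℕ; zero; suc; _+_; _*_; _∸_; _<_; _≤_; _<ᵇ_; _≡ᵇ_; _!; pred; z≤n; s≤s; s≤s⁻¹; s<s⁻¹)
open import Data.Nat.Combinatorics using (_P_; nPn≡n!)
open import Data.Nat.Combinatorics.Base using (_P′_)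
open import Data.Nat.DivMod using (_/_; m*n/n≡m)
open import Data.Nat.Properties as ℕ
  using ( _<?_; <-cmp; <-asym; <⇒≢; >⇒≢; ≤-refl; ≤⇒≯; <⇒≱; ≮⇒≥; ≤⇒≤ᵇ; <ᵇ⇒<; <⇒<ᵇ; 1+n≰n
        ; +-suc; *-suc; +-∸-assoc; n∸n≡0; m∸[m∸n]≡n; pred[m∸n]≡m∸[1+n]; ∸-monoʳ-<; ∸-monoʳ-≤)
open import Data.Product as Product using (_×_; _,_; ∃; proj₁; proj₂; uncurry; swap)
open import Data.Product.Properties using (≡-dec)
open import Data.Sum using (_⊎_; inj₁; inj₂)
open import Data.Vec as Vec using (Vec; lookup; tabulate)
open import Data.Vec.Properties using (∷-injective; lookup∘tabulate; tabulate∘lookup; tabulate-cong)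
import Data.Vec.Relation.Unary.All as VecAll
open import Data.Vec.Relation.Unary.AllPairs using (allPairs?; _∷_)
import Data.Vec.Relation.Unary.Unique.Propositional as Vec
open import Data.Vec.Relation.Unary.Unique.Propositional.Properties using (tabulate⁺; lookup-injective)
open import Function using (_∘_; id; flip; _⇔_; mk⇔; Equivalence; Injective)
open import Function.Construct.Composition using (_⇔-∘_)
open import Relation.Binary.Definitions using (DecidableEquality; tri<; tri≈; tri>)
open import Relation.Binary.PropositionalEquality
open import Relation.Nullary using (Dec; yes; no; does; ¬_; ¬?; contradiction)
open import Relation.Nullary.Decidable using (T?; True; toWitness; from-yes; _×-dec_; dec-true; dec-false)
open import Data.List.Membership.DecPropositional (≡-dec (_≟_ {3}) (_≟_ {3})) using (_∈?_)
open import Data.List.Relation.Binary.Subset.DecPropositional (≡-dec (_≟_ {3}) (_≟_ {3})) using (_⊆?_)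

private
  variable
    A : Set
    m n : ℕ

T-injective : {x y : Bool} → (T x → T y) → (T y → T x) → x ≡ y
T-injective {false} {false} _ _ = refl
T-injective {false} {true}  _ g = ⊥-elim (g _)
T-injective {true}  {false} f _ = ⊥-elim (f _)
T-injective {true}  {true}  _ _ = refl

T-not⇒¬T : {x : Bool} → T (not x) → T x → ⊥
T-not⇒¬T {false} _ ()

∧-cong-T : {a a′ b b′ : Bool} → a ≡ a′ → (T a → b ≡ b′) → a ∧ b ≡ a′ ∧ b′
∧-cong-T {false} refl _ = refl
∧-cong-T {true}  refl f = f _

involutive⇒injective : {f : A → A} → (∀ x → f (f x) ≡ x) → Injective _≡_ _≡_ f
involutive⇒injective {f = f} ff {x} {y} fx≡fy = trans (sym (ff x)) (trans (cong f fx≡fy) (ff y))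

count-map : {B : Set} (p : B → Bool) (f : A → B) (xs : List A) → count p (map f xs) ≡ count (p ∘ f) xs
count-map p f []       = refl
count-map p f (x ∷ xs) = cong (λ c → if p (f x) then suc c else c) (count-map p f xs)

count-cong : (p q : A → Bool) (xs : List A) → (∀ {x} → x ∈ xs → p x ≡ q x) → count p xs ≡ count q xs
count-cong p q []       _   = refl
count-cong p q (x ∷ xs) p≗q rewrite p≗q (here refl) =
  cong (λ c → if q x then suc c else c) (count-cong p q xs (p≗q ∘ there))

count-none : (p : A → Bool) (xs : List A) → (∀ {x} → x ∈ xs → p x ≡ false) → count p xs ≡ 0
count-none p []       _    = refl
count-none p (x ∷ xs) none rewrite none (here refl) = count-none p xs (none ∘ there)

count-≢0 : (p : A → Bool) {x : A} {xs : List A} → x ∈ xs → T (p x) → count p xs ≢ 0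
count-≢0 p {xs = y ∷ xs} (here refl) px with p y | px
... | true | _ = λ ()
count-≢0 p {xs = y ∷ xs} (there x∈xs) px with p y
... | true  = λ ()
... | false = count-≢0 p x∈xs px

count-true : (xs : List A) → count (λ _ → true) xs ≡ length xs
count-true []       = refl
count-true (x ∷ xs) = cong suc (count-true xs)

count-∧ʳ : (p : A → Bool) (b : Bool) (xs : List A) →
           count (λ x → p x ∧ b) xs ≡ (if b then count p xs else 0)
count-∧ʳ p true  xs       = count-cong _ p xs (λ _ → ∧-identityʳ _)
count-∧ʳ p false []       = refl
count-∧ʳ p false (x ∷ xs) rewrite ∧-zeroʳ (p x) = count-∧ʳ p false xs

count-complement : (p : A → Bool) (xs : List A) → count p xs + count (not ∘ p) xs ≡ length xs
count-complement p []       = refl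
count-complement p (x ∷ xs) with p x
... | true  = cong suc (count-complement p xs)
... | false = trans (+-suc _ _) (cong suc (count-complement p xs))

length-filterᵇ : (p : A → Bool) (xs : List A) → length (filterᵇ p xs) ≡ count p xs
length-filterᵇ p []       = refl
length-filterᵇ p (x ∷ xs) with p x
... | true  = cong suc (length-filterᵇ p xs)
... | false = length-filterᵇ p xs

count-++ : (p : A → Bool) (xs ys : List A) → count p (xs ++ ys) ≡ count p xs + count p ys
count-++ p []       ys = refl
count-++ p (x ∷ xs) ys with p x
... | true  = cong suc (count-++ p xs ys)
... | false = count-++ p xs ys

count-concatMap : {B : Set} (p : B → Bool) (f : A → List B) (q : A → Bool) (c : ℕ) →
                  (∀ x → count p (f x) ≡ (if q x then c else 0)) →
                  ∀ xs → count p (concatMap f xs) ≡ c * count q xs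
count-concatMap p f q c block []       = sym (ℕ.*-zeroʳ c)
count-concatMap p f q c block (x ∷ xs) with q x | block x
... | true  | fx = trans (count-++ p (f x) _)
                         (trans (cong₂ _+_ fx (count-concatMap p f q c block xs)) (sym (*-suc c _)))
... | false | fx = trans (count-++ p (f x) _) (cong₂ _+_ fx (count-concatMap p f q c block xs))

count-↭ : (p : A → Bool) {xs ys : List A} → xs ↭ ys → count p xs ≡ count p ys
count-↭ p ↭.refl                 = refl
count-↭ p (↭.prep x xs↭ys)       = cong (λ c → if p x then suc c else c) (count-↭ p xs↭ys)
count-↭ p (↭.swap x y xs↭ys) with p x | p y | count-↭ p xs↭ys
... | true  | true  | eq = cong (suc ∘ suc) eq
... | true  | false | eq = cong suc eq
... | false | true  | eq = cong suc eq
... | false | false | eq = eq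
count-↭ p (↭.trans xs↭ys ys↭zs) = trans (count-↭ p xs↭ys) (count-↭ p ys↭zs)

module _ {xs : List A} (xs! : Unique xs) (f g : A → A)
         (f-∈ : ∀ {x} → x ∈ xs → f x ∈ xs) (g-∈ : ∀ {x} → x ∈ xs → g x ∈ xs)
         (g∘f : ∀ {x} → x ∈ xs → g (f x) ≡ x) (f∘g : ∀ {x} → x ∈ xs → f (g x) ≡ x) where

  map-inverse-↭ : map f xs ↭ xs
  map-inverse-↭ = ∼bag⇒↭ (unique∧set⇒bag fxs! xs! (mk⇔ to from))
    where
    gfxs≡xs : map g (map f xs) ≡ xs
    gfxs≡xs = trans (sym (map-∘ xs)) (map-id-local (All.tabulate g∘f))
    fxs! : Unique (map f xs)
    fxs! = Unique.map⁻ (subst Unique (sym gfxs≡xs) xs!)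
    to : ∀ {y} → y ∈ map f xs → y ∈ xs
    to y∈fxs with x , x∈xs , refl ← ∈-map⁻ f y∈fxs = f-∈ x∈xs
    from : ∀ {y} → y ∈ xs → y ∈ map f xs
    from y∈xs = subst (_∈ map f xs) (f∘g y∈xs) (∈-map⁺ f (g-∈ y∈xs))

  count-∘-inverse : (p : A → Bool) → count (p ∘ f) xs ≡ count p xs
  count-∘-inverse p = trans (sym (count-map p f xs)) (count-↭ p map-inverse-↭)

any-allFin-∘ : (p : Fin n → Bool) (σ τ : Fin n → Fin n) → (∀ k → σ (τ k) ≡ k) →
               any (p ∘ σ) (allFin n) ≡ any p (allFin n)
any-allFin-∘ {n} p σ τ στ = T-injective to from
  where
  to : T (any (p ∘ σ) (allFin n)) → T (any p (allFin n))
  to h with k , pσk ← satisfied (any⁻ (p ∘ σ) (allFin n) h) = any⁺ p (lose (∈-allFin (σ k)) pσk)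
  from : T (any p (allFin n)) → T (any (p ∘ σ) (allFin n))
  from h with k , pk ← satisfied (any⁻ p (allFin n) h) =
    any⁺ (p ∘ σ) (lose (∈-allFin (τ k)) (subst (T ∘ p) (sym (στ k)) pk))

module _ {A : Set} (_≟ᴬ_ : DecidableEquality A) (q : A → Bool) {b : A} where

  count-except-∉ : {xs : List A} → b ∉ xs → count (λ a → not (does (a ≟ᴬ b)) ∧ q a) xs ≡ count q xs
  count-except-∉ b∉xs = count-cong _ q _ λ {a} a∈xs →
    cong (λ d → not d ∧ q a) (dec-false (a ≟ᴬ b) λ { refl → b∉xs a∈xs })

  count-except : {xs : List A} → Unique xs → b ∈ xs → q b ≡ true →
                 count q xs ≡ suc (count (λ a → not (does (a ≟ᴬ b)) ∧ q a) xs)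
  count-except (b∉xs ∷ _) (here refl) qb rewrite dec-true (b ≟ᴬ b) refl | qb =
    cong suc (sym (count-except-∉ (All¬⇒¬Any b∉xs)))
  count-except {x ∷ _} (x∉xs ∷ xs!) (there b∈xs) qb
    rewrite dec-false (x ≟ᴬ b) (All.lookup x∉xs b∈xs) with q x
  ... | true  = cong suc (count-except xs! b∈xs qb)
  ... | false = count-except xs! b∈xs qb

-- Enumerating pairs, words and permutations

concatMap-map : {B C : Set} (f : A → B → C) (xs : List A) (ys : List B) →
                concatMap (λ x → map (f x) ys) xs ≡ cartesianProductWith f xs ys
concatMap-map f []       ys = refl
concatMap-map f (x ∷ xs) ys = cong (map (f x) ys ++_) (concatMap-map f xs ys)

pairs : (n : ℕ) → List (Fin n × Fin n)
pairs n = cartesianProduct (allFin n) (allFin n)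

pairs-unique : Unique (pairs n)
pairs-unique = cartesianProduct⁺ (allFin⁺ _) (allFin⁺ _)

∈-pairs : (ij : Fin n × Fin n) → ij ∈ pairs n
∈-pairs (i , j) = ∈-cartesianProduct⁺ (∈-allFin i) (∈-allFin j)

occ≡count-pairs : (R : MeshSet) (π : Vec (Fin n) n) → occ R π ≡ count (uncurry (isOcc R π)) (pairs n)
occ≡count-pairs {n} R π = cong (count _) (concatMap-map _,_ (allFin n) (allFin n))

allVecs-suc : allVecs (suc m) n ≡ cartesianProductWith (flip Vec._∷_) (allVecs m n) (allFin n)
allVecs-suc {m} {n} = concatMap-map (flip Vec._∷_) (allVecs m n) (allFin n)

allVecs-unique : ∀ m → Unique (allVecs m n)
allVecs-unique zero    = [] ∷ []
allVecs-unique (suc m) = subst Unique (sym allVecs-suc)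
  (cartesianProductWith⁺ _ (swap ∘ ∷-injective) (allVecs-unique m) (allFin⁺ _))

∈-allVecs : (v : Vec (Fin n) m) → v ∈ allVecs m n
∈-allVecs Vec.[]      = here refl
∈-allVecs (a Vec.∷ v) = subst (a Vec.∷ v ∈_) (sym allVecs-suc)
  (∈-cartesianProductWith⁺ (flip Vec._∷_) (∈-allVecs v) (∈-allFin a))

Sn-unique : Unique (Sn n)
Sn-unique {n} = filter⁺ (T? ∘ isPerm) (allVecs-unique n)

∈-Sn⇔isPerm : {π : Vec (Fin n) n} → π ∈ Sn n ⇔ T (isPerm π)
∈-Sn⇔isPerm {n} = mk⇔ (proj₂ ∘ ∈-filter⁻ (T? ∘ isPerm) {xs = allVecs n n})
                      (∈-filter⁺ (T? ∘ isPerm) (∈-allVecs _))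

IsPerm : Vec (Fin n) n → Set
IsPerm π = Injective _≡_ _≡_ (lookup π)

T-all-allFin : {p : Fin n → Bool} → T (all p (allFin n)) ⇔ (∀ i → T (p i))
T-all-allFin {n} {p} = mk⇔ (λ h i → All.lookup (all⁺ p (allFin n) h) (∈-allFin i))
                           (λ h → all⁻ p (All.tabulate {xs = allFin n} (λ {i} _ → h i)))

isPerm⇔IsPerm : {π : Vec (Fin n) n} → T (isPerm π) ⇔ IsPerm π
isPerm⇔IsPerm {π = π} = mk⇔ to from
  where
  to : T (isPerm π) → IsPerm π
  to perm {i} {j} πi≡πj
    with Equivalence.to T-∨ (Equivalence.to T-all-allFin (Equivalence.to T-all-allFin perm i) j)
  ... | inj₁ i≡ᵇj   = toℕ-injective (ℕ.≡ᵇ⇒≡ _ _ i≡ᵇj)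
  ... | inj₂ πi≢ᵇπj = ⊥-elim (subst T (Equivalence.to T-not-≡ πi≢ᵇπj) (ℕ.≡⇒≡ᵇ _ _ (cong toℕ πi≡πj)))
  from : IsPerm π → T (isPerm π)
  from inj = Equivalence.from T-all-allFin λ i → Equivalence.from T-all-allFin λ j →
             Equivalence.from T-∨ (equal-or-distinct i j)
    where
    equal-or-distinct : ∀ i j → T (toℕ i ≡ᵇ toℕ j) ⊎ T (not (toℕ (lookup π i) ≡ᵇ toℕ (lookup π j)))
    equal-or-distinct i j with i ≟ j
    ... | yes i≡j = inj₁ (ℕ.≡⇒≡ᵇ _ _ (cong toℕ i≡j))
    ... | no  i≢j = inj₂ (Equivalence.from T-not-≡
                           (dec-false (toℕ (lookup π i) ℕ.≟ toℕ (lookup π j)) (i≢j ∘ inj ∘ toℕ-injective)))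

∈-Sn⇔IsPerm : {π : Vec (Fin n) n} → π ∈ Sn n ⇔ IsPerm π
∈-Sn⇔IsPerm {π = π} = isPerm⇔IsPerm {π = π} ⇔-∘ ∈-Sn⇔isPerm

IsPerm⇔Unique : {π : Vec (Fin n) n} → IsPerm π ⇔ Vec.Unique π
IsPerm⇔Unique {π = π} = mk⇔ to (λ π! → lookup-injective π! _ _)
  where
  to : IsPerm π → Vec.Unique π
  to inj = subst Vec.Unique (tabulate∘lookup π) (tabulate⁺ inj)

distinct? : (v : Vec (Fin n) m) → Dec (Vec.Unique v)
distinct? = allPairs? (λ a b → ¬? (a ≟ b))

fresh : Vec (Fin n) m → Fin n → Bool
fresh v a = does (VecAll.all? (λ b → ¬? (a ≟ b)) v)

isPerm≡distinct? : (π : Vec (Fin n) n) → isPerm π ≡ does (distinct? π)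
isPerm≡distinct? π with distinct? π
... | yes π! = T-injective _ (λ _ → Equivalence.from (IsPerm⇔Unique ⇔-∘ isPerm⇔IsPerm {π = π}) π!)
... | no ¬π! = T-injective (¬π! ∘ Equivalence.to (IsPerm⇔Unique ⇔-∘ isPerm⇔IsPerm {π = π})) (λ ())

count-fresh : {v : Vec (Fin n) m} → Vec.Unique v → count (fresh v) (allFin n) ≡ n ∸ m
count-fresh {n} {v = Vec.[]} _ = trans (count-true (allFin n)) (length-tabulate _)
count-fresh {n} {suc m} {b Vec.∷ w} (b∉w ∷ w!) = begin
  count (fresh (b Vec.∷ w)) (allFin n)   ≡⟨ cong pred (sym without-b) ⟩
  pred (count (fresh w) (allFin n))      ≡⟨ cong pred (count-fresh w!) ⟩
  pred (n ∸ m)                           ≡⟨ pred[m∸n]≡m∸[1+n] n m ⟩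
  n ∸ suc m                              ∎
  where
  open ≡-Reasoning
  without-b : count (fresh w) (allFin n) ≡ suc (count (fresh (b Vec.∷ w)) (allFin n))
  without-b = count-except _≟_ (fresh w) (allFin⁺ n) (∈-allFin b) (dec-true (VecAll.all? _ w) b∉w)

count-distinct : ∀ m → count (does ∘ distinct?) (allVecs m n) ≡ n P′ m
count-distinct zero        = refl
count-distinct {n} (suc m) = trans
  (count-concatMap (does ∘ distinct?) (λ v → map (Vec._∷ v) (allFin n)) (does ∘ distinct?) (n ∸ m)
                   extensions (allVecs m n))
  (cong ((n ∸ m) *_) (count-distinct m))
  where
  fresh-count : (v : Vec (Fin n) m) (v? : Dec (Vec.Unique v)) →
                (if does v? then count (fresh v) (allFin n) else 0) ≡ (if does v? then n ∸ m else 0)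
  fresh-count v (yes v!) = count-fresh v!
  fresh-count v (no _)   = refl
  extensions : ∀ v → count (does ∘ distinct?) (map (Vec._∷ v) (allFin n)) ≡
                     (if does (distinct? v) then n ∸ m else 0)
  extensions v = trans (count-map _ _ (allFin n))
                       (trans (count-∧ʳ (fresh v) _ (allFin n)) (fresh-count v (distinct? v)))

length-Sn : length (Sn n) ≡ n !
length-Sn {n} = begin
  length (Sn n)                          ≡⟨ length-filterᵇ isPerm (allVecs n n) ⟩
  count isPerm (allVecs n n)             ≡⟨ count-cong _ _ (allVecs n n) (λ {π} _ → isPerm≡distinct? π) ⟩
  count (does ∘ distinct?) (allVecs n n) ≡⟨ count-distinct n ⟩
  n P′ n                                 ≡⟨ cong (λ b → if b then n P′ n else 0)
                                                 (sym (Equivalence.to T-≡ (≤⇒≤ᵇ (≤-refl {n})))) ⟩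
  n P n                                  ≡⟨ nPn≡n! n ⟩
  n !                                    ∎
  where open ≡-Reasoning

IsPerm⇒surjective : (π : Vec (Fin n) n) → IsPerm π → ∀ v → ∃ λ i → lookup π i ≡ v
IsPerm⇒surjective {suc n} π inj v with any? (λ i → lookup π i ≟ v)
... | yes hit  = hit
... | no  miss = contradiction (injective⇒≤ squeeze-injective) 1+n≰n
  where
  -- π misses v, so it injects Fin (suc n) into Fin (suc n) ∖ {v} ≅ Fin n
  squeeze : Fin (suc n) → Fin n
  squeeze i = punchOut {i = v} {j = lookup π i} (λ v≡πi → miss (i , sym v≡πi))
  squeeze-injective : Injective _≡_ _≡_ squeeze
  squeeze-injective {i} {j} eq = inj (punchOut-injective {i = v} {j = lookup π i} {k = lookup π j} _ _ eq)

-- junk value v when π does not attain v, which never happens for permutations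
preimage : Vec (Fin n) n → Fin n → Fin n
preimage π v with any? (λ i → lookup π i ≟ v)
... | yes (i , _) = i
... | no  _       = v

lookup-preimage : (π : Vec (Fin n) n) → IsPerm π → ∀ v → lookup π (preimage π v) ≡ v
lookup-preimage π inj v with any? (λ i → lookup π i ≟ v)
... | yes (_ , πi≡v) = πi≡v
... | no  miss       = contradiction (IsPerm⇒surjective π inj v) miss

preimage-lookup : (π : Vec (Fin n) n) → IsPerm π → ∀ i → preimage π (lookup π i) ≡ i
preimage-lookup π inj i = inj (lookup-preimage π inj _)

inverse : Vec (Fin n) n → Vec (Fin n) n
inverse π = tabulate (preimage π)

inverse-IsPerm : (π : Vec (Fin n) n) → IsPerm π → IsPerm (inverse π)
inverse-IsPerm π inj {v} {w} eq = begin
  v                                ≡⟨ sym (lookup-preimage π inj v) ⟩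
  lookup π (preimage π v)          ≡⟨ cong (lookup π) (sym (lookup∘tabulate _ v)) ⟩
  lookup π (lookup (inverse π) v)  ≡⟨ cong (lookup π) eq ⟩
  lookup π (lookup (inverse π) w)  ≡⟨ cong (lookup π) (lookup∘tabulate _ w) ⟩
  lookup π (preimage π w)          ≡⟨ lookup-preimage π inj w ⟩
  w                                ∎
  where open ≡-Reasoning

inverse-involutive : (π : Vec (Fin n) n) → IsPerm π → inverse (inverse π) ≡ π
inverse-involutive π inj = trans (tabulate-cong entry) (tabulate∘lookup π)
  where
  π⁻¹-inj : IsPerm (inverse π)
  π⁻¹-inj = inverse-IsPerm π inj
  entry : ∀ i → preimage (inverse π) i ≡ lookup π i
  entry i = π⁻¹-inj (begin
    lookup (inverse π) (preimage (inverse π) i) ≡⟨ lookup-preimage (inverse π) π⁻¹-inj i ⟩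
    i                                          ≡⟨ sym (preimage-lookup π inj i) ⟩
    preimage π (lookup π i)                    ≡⟨ sym (lookup∘tabulate _ (lookup π i)) ⟩
    lookup (inverse π) (lookup π i)            ∎)
    where open ≡-Reasoning

relabel : (Fin n → Fin n) → (Fin n → Fin n) → Vec (Fin n) n → Vec (Fin n) n
relabel τ σ π = tabulate (τ ∘ lookup π ∘ σ)

lookup-relabel : (τ σ : Fin n → Fin n) (π : Vec (Fin n) n) (k : Fin n) →
                 lookup (relabel τ σ π) k ≡ τ (lookup π (σ k))
lookup-relabel τ σ π = lookup∘tabulate _

relabel-IsPerm : {τ σ : Fin n → Fin n} → Injective _≡_ _≡_ τ → Injective _≡_ _≡_ σ →
                 (π : Vec (Fin n) n) → IsPerm π → IsPerm (relabel τ σ π)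
relabel-IsPerm {τ = τ} {σ} τ-inj σ-inj π π-inj {i} {j} eq =
  σ-inj (π-inj (τ-inj (trans (sym (lookup-relabel τ σ π i)) (trans eq (lookup-relabel τ σ π j)))))

relabel-involutive : {τ σ : Fin n → Fin n} → (∀ a → τ (τ a) ≡ a) → (∀ k → σ (σ k) ≡ k) →
                     (π : Vec (Fin n) n) → relabel τ σ (relabel τ σ π) ≡ π
relabel-involutive {τ = τ} {σ} ττ σσ π = trans (tabulate-cong entry) (tabulate∘lookup π)
  where
  entry : ∀ k → τ (lookup (relabel τ σ π) (σ k)) ≡ lookup π k
  entry k = trans (cong τ (lookup-relabel τ σ π (σ k))) (trans (ττ _) (cong (lookup π) (σσ k)))

record OccurrenceInvolution (n : ℕ) (R R′ : MeshSet) : Set where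
  field
    φ            : Vec (Fin n) n → Vec (Fin n) n
    φ-IsPerm     : (π : Vec (Fin n) n) → IsPerm π → IsPerm (φ π)
    φ-involutive : (π : Vec (Fin n) n) → IsPerm π → φ (φ π) ≡ π
    occ-φ        : (π : Vec (Fin n) n) → IsPerm π → occ R (φ π) ≡ occ R′ π

∈-Sn⇒IsPerm : {π : Vec (Fin n) n} → π ∈ Sn n → IsPerm π
∈-Sn⇒IsPerm {π = π} = Equivalence.to (∈-Sn⇔IsPerm {π = π})

count-Sn-∘-involution : (φ : Vec (Fin n) n → Vec (Fin n) n) → (∀ π → IsPerm π → IsPerm (φ π)) →
                        (∀ π → IsPerm π → φ (φ π) ≡ π) → (p : Vec (Fin n) n → Bool) →
                        count (p ∘ φ) (Sn n) ≡ count p (Sn n)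
count-Sn-∘-involution {n} φ φ-IsPerm φ-involutive = count-∘-inverse Sn-unique φ φ φ-∈ φ-∈ φφ φφ
  where
  φ-∈ : {π : Vec (Fin n) n} → π ∈ Sn n → φ π ∈ Sn n
  φ-∈ {π} = Equivalence.from (∈-Sn⇔IsPerm {π = φ π}) ∘ φ-IsPerm π ∘ ∈-Sn⇒IsPerm
  φφ : {π : Vec (Fin n) n} → π ∈ Sn n → φ (φ π) ≡ π
  φφ {π} = φ-involutive π ∘ ∈-Sn⇒IsPerm

s-cong : {R R′ : MeshSet} → OccurrenceInvolution n R R′ → ∀ k → s n k R ≡ s n k R′
s-cong {n} {R} {R′} ι k = begin
  count (λ π → occ R π ≡ᵇ k) (Sn n)      ≡⟨ sym (count-Sn-∘-involution φ φ-IsPerm φ-involutive _) ⟩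
  count (λ π → occ R (φ π) ≡ᵇ k) (Sn n)  ≡⟨ count-cong _ _ (Sn n) (λ π∈ → cong (_≡ᵇ k) (occ-φ _ (∈-Sn⇒IsPerm π∈))) ⟩
  count (λ π → occ R′ π ≡ᵇ k) (Sn n)     ∎
  where
  open ≡-Reasoning
  open OccurrenceInvolution ι

-- Diagrams, boxes and occurrences

Box : Set
Box = Fin 3 × Fin 3

column : Fin n → ℕ
column k = suc (toℕ k)

column-injective : {i j : Fin n} → column i ≡ column j → i ≡ j
column-injective = toℕ-injective ∘ ℕ.suc-injective

column≤ : (k : Fin n) → column k ≤ suc n
column≤ k = s≤s (ℕ.<⇒≤ (toℕ<n k))

column<suc : (k : Fin n) → column k < suc n
column<suc k = s≤s (toℕ<n k)

inStrip : ℕ → ℕ → ℕ → Fin 3 → ℕ → Bool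
inStrip n lo hi a K = btw (lowC n lo hi a) K (upC n lo hi a)

inStrip-cong : {lo lo′ hi hi′ K K′ : ℕ} (a : Fin 3) → lo ≡ lo′ → hi ≡ hi′ → K ≡ K′ →
               inStrip n lo hi a K ≡ inStrip n lo′ hi′ a K′
inStrip-cong a refl refl refl = refl

inBox : Vec (Fin n) n → Fin n → Fin n → Box → Fin n → Bool
inBox {n} π i j (a , b) k =
  inStrip n (column i) (column j) a (column k) ∧ inStrip n (val π i) (val π j) b (val π k)

ascent : Vec (Fin n) n → Fin n → Fin n → Bool
ascent π i j = (column i <ᵇ column j) ∧ (val π i <ᵇ val π j)

ascent⇒column< : (π : Vec (Fin n) n) (i j : Fin n) → T (ascent π i j) → column i < column j
ascent⇒column< π i j = <ᵇ⇒< _ _ ∘ proj₁ ∘ Equivalence.to T-∧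

ascent⇒val< : (π : Vec (Fin n) n) (i j : Fin n) → T (ascent π i j) → val π i < val π j
ascent⇒val< π i j = <ᵇ⇒< _ _ ∘ proj₂ ∘ Equivalence.to (T-∧ {column i <ᵇ column j})

boxesEmpty : MeshSet → Vec (Fin n) n → Fin n → Fin n → Bool
boxesEmpty {n} R π i j = all (λ ab → not (any (inBox π i j ab) (allFin n))) R

isOcc≡ascent∧boxesEmpty : (R : MeshSet) (π : Vec (Fin n) n) (i j : Fin n) →
                          isOcc R π i j ≡ ascent π i j ∧ boxesEmpty R π i j
isOcc≡ascent∧boxesEmpty R π i j = sym (∧-assoc (column i <ᵇ column j) (val π i <ᵇ val π j) _)

module _ (R : MeshSet) (t : Box → Box) (σ τ : Fin n → Fin n) (στ : ∀ k → σ (τ k) ≡ k)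
         (π′ : Vec (Fin n) n) (i j : Fin n) (π : Vec (Fin n) n) (i′ j′ : Fin n) where

  boxesEmpty-transport : (∀ ab k → inBox π′ i j ab k ≡ inBox π i′ j′ (t ab) (σ k)) →
                         boxesEmpty R π′ i j ≡ boxesEmpty (map t R) π i′ j′
  boxesEmpty-transport boxes = trans (cong and (map-cong empty R)) (cong and (map-∘ R))
    where
    empty : ∀ ab → not (any (inBox π′ i j ab) (allFin n)) ≡ not (any (inBox π i′ j′ (t ab)) (allFin n))
    empty ab = cong not (trans (cong or (map-cong (boxes ab) (allFin n))) (any-allFin-∘ _ σ τ στ))

  isOcc-transport : ascent π′ i j ≡ ascent π i′ j′ →
                    (T (ascent π′ i j) → ∀ ab k → inBox π′ i j ab k ≡ inBox π i′ j′ (t ab) (σ k)) →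
                    isOcc R π′ i j ≡ isOcc (map t R) π i′ j′
  isOcc-transport ascents boxes = begin
    isOcc R π′ i j                                ≡⟨ isOcc≡ascent∧boxesEmpty R π′ i j ⟩
    ascent π′ i j ∧ boxesEmpty R π′ i j           ≡⟨ ∧-cong-T ascents (boxesEmpty-transport ∘ boxes) ⟩
    ascent π i′ j′ ∧ boxesEmpty (map t R) π i′ j′ ≡⟨ sym (isOcc≡ascent∧boxesEmpty (map t R) π i′ j′) ⟩
    isOcc (map t R) π i′ j′                       ∎
    where open ≡-Reasoning

occ-transport : {R R′ : MeshSet} {π′ π : Vec (Fin n) n} (g h : Fin n × Fin n → Fin n × Fin n) →
                (∀ p → h (g p) ≡ p) → (∀ p → g (h p) ≡ p) →
                (∀ p → uncurry (isOcc R π′) p ≡ uncurry (isOcc R′ π) (g p)) → occ R π′ ≡ occ R′ π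
occ-transport {n} {R} {R′} {π′} {π} g h hg gh occurrence = begin
  occ R π′                                   ≡⟨ occ≡count-pairs R π′ ⟩
  count (uncurry (isOcc R π′)) (pairs n)     ≡⟨ count-cong _ _ (pairs n) (λ {p} _ → occurrence p) ⟩
  count (uncurry (isOcc R′ π) ∘ g) (pairs n) ≡⟨ count-∘-inverse pairs-unique g h (λ _ → ∈-pairs _) (λ _ → ∈-pairs _)
                                                                 (λ {p} _ → hg p) (λ {p} _ → gh p) _ ⟩
  count (uncurry (isOcc R′ π)) (pairs n)     ≡⟨ sym (occ≡count-pairs R′ π) ⟩
  occ R′ π                                   ∎
  where open ≡-Reasoning

-- Reverse-complement and inverse

<ᵇ-reflect : {N a b : ℕ} → a ≤ N → (N ∸ a <ᵇ N ∸ b) ≡ (b <ᵇ a)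
<ᵇ-reflect {N} {a} {b} a≤N =
  T-injective (<⇒<ᵇ ∘ reflected ∘ <ᵇ⇒< _ _) (λ b<a → <⇒<ᵇ (∸-monoʳ-< (<ᵇ⇒< _ _ b<a) a≤N))
  where
  reflected : N ∸ a < N ∸ b → b < a
  reflected N∸a<N∸b with b <? a
  ... | yes b<a = b<a
  ... | no  b≮a = contradiction (∸-monoʳ-≤ N (≮⇒≥ b≮a)) (<⇒≱ N∸a<N∸b)

btw-reflect : {M lo K hi : ℕ} → K ≤ M → hi ≤ M → btw lo K hi ≡ btw (M ∸ hi) (M ∸ K) (M ∸ lo)
btw-reflect {lo = lo} {K} {hi} K≤M hi≤M =
  trans (∧-comm (lo <ᵇ K) (K <ᵇ hi)) (sym (cong₂ _∧_ (<ᵇ-reflect hi≤M) (<ᵇ-reflect K≤M)))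

btw-below : {lo K hi : ℕ} → K ≤ lo → btw lo K hi ≡ false
btw-below {lo} {K} {hi} K≤lo = cong (_∧ (K <ᵇ hi)) (dec-false (lo <? K) (≤⇒≯ K≤lo))

btw-above : {lo K hi : ℕ} → hi ≤ K → btw lo K hi ≡ false
btw-above {lo} {K} {hi} hi≤K =
  trans (cong ((lo <ᵇ K) ∧_) (dec-false (K <? hi) (≤⇒≯ hi≤K))) (∧-zeroʳ (lo <ᵇ K))

inStrip-rotate : {x₁ x₂ K : ℕ} → x₁ ≤ suc n → x₂ ≤ suc n → K ≤ suc n → (a : Fin 3) →
                 inStrip n x₁ x₂ a K ≡ inStrip n (suc n ∸ x₂) (suc n ∸ x₁) (opposite a) (suc n ∸ K)
inStrip-rotate x₁≤ x₂≤ K≤ 0F = btw-reflect K≤ x₁≤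
inStrip-rotate x₁≤ x₂≤ K≤ 1F = btw-reflect K≤ x₂≤
inStrip-rotate {n} {x₂ = x₂} {K} x₁≤ x₂≤ K≤ 2F =
  trans (btw-reflect K≤ ≤-refl) (cong (λ lo → btw lo (suc n ∸ K) (suc n ∸ x₂)) (n∸n≡0 (suc n)))

column-opposite : (k : Fin n) → column (opposite k) ≡ suc n ∸ column k
column-opposite k = trans (cong suc (opposite-prop k)) (sym (+-∸-assoc 1 (toℕ<n k)))

rotate : Vec (Fin n) n → Vec (Fin n) n
rotate = relabel opposite opposite

rotateBox : Box → Box
rotateBox = Product.map opposite opposite

val-rotate : (π : Vec (Fin n) n) (k : Fin n) → val (rotate π) k ≡ suc n ∸ val π (opposite k)
val-rotate π k = trans (cong column (lookup-relabel opposite opposite π k)) (column-opposite _)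

occ-rotate : (R : MeshSet) (π : Vec (Fin n) n) → occ R (rotate π) ≡ occ (map rotateBox R) π
occ-rotate {n} R π =
  occ-transport {R = R} {map rotateBox R} {rotate π} {π} flipPair flipPair flipPair² flipPair² occurrence
  where
  flipPair : Fin n × Fin n → Fin n × Fin n
  flipPair (i , j) = opposite j , opposite i
  flipPair² : ∀ p → flipPair (flipPair p) ≡ p
  flipPair² (i , j) = cong₂ _,_ (opposite-involutive i) (opposite-involutive j)
  val≤ : ∀ k → val π k ≤ suc n
  val≤ k = column≤ (lookup π k)
  occurrence : ∀ p → uncurry (isOcc R (rotate π)) p ≡ uncurry (isOcc (map rotateBox R) π) (flipPair p)
  occurrence (i , j) =
    isOcc-transport R rotateBox opposite opposite opposite-involutive (rotate π) i j π (opposite j) (opposite i)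
                    ascents (λ _ → boxes)
    where
    ascents : ascent (rotate π) i j ≡ ascent π (opposite j) (opposite i)
    ascents = cong₂ _∧_
      (sym (trans (cong₂ _<ᵇ_ (column-opposite j) (column-opposite i)) (<ᵇ-reflect {b = column i} (column≤ j))))
      (trans (cong₂ _<ᵇ_ (val-rotate π i) (val-rotate π j))
             (<ᵇ-reflect {b = val π (opposite j)} (val≤ (opposite i))))
    boxes : ∀ ab k → inBox (rotate π) i j ab k ≡ inBox π (opposite j) (opposite i) (rotateBox ab) (opposite k)
    boxes (a , b) k = cong₂ _∧_
      (trans (inStrip-rotate (column≤ i) (column≤ j) (column≤ k) a)
             (sym (inStrip-cong (opposite a) (column-opposite j) (column-opposite i) (column-opposite k))))
      (trans (inStrip-cong b (val-rotate π i) (val-rotate π j) (val-rotate π k))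
             (sym (trans (inStrip-rotate (val≤ _) (val≤ _) (val≤ _) (opposite b))
                         (cong (λ c → inStrip n _ _ c _) (opposite-involutive b)))))

occ-inverse : (R : MeshSet) (π : Vec (Fin n) n) → IsPerm π → occ R (inverse π) ≡ occ (map swap R) π
occ-inverse {n} R π inj =
  occ-transport {R = R} {map swap R} {inverse π} {π} (Product.map pre pre) (Product.map (lookup π) (lookup π))
    (λ (i , j) → cong₂ _,_ (lookup-preimage π inj i) (lookup-preimage π inj j))
    (λ (i , j) → cong₂ _,_ (preimage-lookup π inj i) (preimage-lookup π inj j))
    occurrence
  where
  pre : Fin n → Fin n
  pre = preimage π
  val-inverse : ∀ v → val (inverse π) v ≡ column (pre v)
  val-inverse v = cong column (lookup∘tabulate pre v)
  val-pre : ∀ v → val π (pre v) ≡ column v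
  val-pre v = cong column (lookup-preimage π inj v)
  occurrence : ∀ p → uncurry (isOcc R (inverse π)) p ≡ uncurry (isOcc (map swap R) π) (Product.map pre pre p)
  occurrence (i , j) =
    isOcc-transport R swap pre (lookup π) (preimage-lookup π inj) (inverse π) i j π (pre i) (pre j)
                    ascents (λ _ → boxes)
    where
    ascents : ascent (inverse π) i j ≡ ascent π (pre i) (pre j)
    ascents = trans (cong₂ _∧_ (sym (cong₂ _<ᵇ_ (val-pre i) (val-pre j)))
                               (cong₂ _<ᵇ_ (val-inverse i) (val-inverse j)))
                    (∧-comm (val π (pre i) <ᵇ val π (pre j)) _)
    boxes : ∀ ab k → inBox (inverse π) i j ab k ≡ inBox π (pre i) (pre j) (swap ab) (pre k)
    boxes (a , b) k = trans
      (cong₂ _∧_ (inStrip-cong a (sym (val-pre i)) (sym (val-pre j)) (sym (val-pre k)))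
                 (inStrip-cong b (val-inverse i) (val-inverse j) (val-inverse k)))
      (∧-comm (inStrip n (val π (pre i)) (val π (pre j)) a (val π (pre k))) _)

-- Prefix reversal

-- k ↦ m ∸ 1 ∸ k below m (positions are 0-based), the identity from m on
reflectBelow : Fin n → Fin n → Fin n
reflectBelow m k with toℕ k <? toℕ m
... | yes _ = Fin.fromℕ< (ℕ.≤-<-trans (ℕ.m∸n≤m (toℕ m) (suc (toℕ k))) (toℕ<n m))
... | no  _ = k

column-reflectBelow : (m k : Fin n) → toℕ k < toℕ m → column (reflectBelow m k) ≡ column m ∸ column k
column-reflectBelow m k k<m with toℕ k <? toℕ m
... | yes _   = trans (cong suc (toℕ-fromℕ< _)) (sym (+-∸-assoc 1 k<m))
... | no  k≮m = contradiction k<m k≮m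

reflectBelow-fixed : (m k : Fin n) → ¬ toℕ k < toℕ m → reflectBelow m k ≡ k
reflectBelow-fixed m k k≮m with toℕ k <? toℕ m
... | yes k<m = contradiction k<m k≮m
... | no  _   = refl

reflectBelow-self : (m : Fin n) → reflectBelow m m ≡ m
reflectBelow-self m = reflectBelow-fixed m m (ℕ.<-irrefl refl)

reflectBelow-< : (m k : Fin n) → toℕ k < toℕ m → toℕ (reflectBelow m k) < toℕ m
reflectBelow-< m k k<m = s<s⁻¹ (subst (_< column m) (sym (column-reflectBelow m k k<m))
                                      (∸-monoʳ-< {o = 0} (s≤s z≤n) (s≤s (ℕ.<⇒≤ k<m))))

reflectBelow-involutive : (m k : Fin n) → reflectBelow m (reflectBelow m k) ≡ k
reflectBelow-involutive m k = by-cases (toℕ k <? toℕ m)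
  where
  by-cases : Dec (toℕ k < toℕ m) → reflectBelow m (reflectBelow m k) ≡ k
  by-cases (yes k<m) = column-injective (begin
    column (reflectBelow m (reflectBelow m k)) ≡⟨ column-reflectBelow m (reflectBelow m k) (reflectBelow-< m k k<m) ⟩
    column m ∸ column (reflectBelow m k)       ≡⟨ cong (column m ∸_) (column-reflectBelow m k k<m) ⟩
    column m ∸ (column m ∸ column k)           ≡⟨ m∸[m∸n]≡n (s≤s (ℕ.<⇒≤ k<m)) ⟩
    column k                                   ∎)
    where open ≡-Reasoning
  by-cases (no k≮m) = trans (cong (reflectBelow m) (reflectBelow-fixed m k k≮m)) (reflectBelow-fixed m k k≮m)

column<ᵇ-reflectBelow : (m i : Fin n) →
                        (column i <ᵇ column m) ≡ (column (reflectBelow m i) <ᵇ column (reflectBelow m m))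
column<ᵇ-reflectBelow m i =
  trans (by-cases (toℕ i <? toℕ m))
        (cong (λ c → column (reflectBelow m i) <ᵇ column c) (sym (reflectBelow-self m)))
  where
  by-cases : Dec (toℕ i < toℕ m) → (column i <ᵇ column m) ≡ (column (reflectBelow m i) <ᵇ column m)
  by-cases (yes i<m) = trans (dec-true (column i <? column m) (s≤s i<m))
                             (sym (dec-true (column (reflectBelow m i) <? column m) (s≤s (reflectBelow-< m i i<m))))
  by-cases (no i≮m)  = cong (λ c → column c <ᵇ column m) (sym (reflectBelow-fixed m i i≮m))

swap01 : Fin 3 → Fin 3
swap01 0F = 1F
swap01 1F = 0F
swap01 2F = 2F

swapColumns01 : Box → Box
swapColumns01 = Product.map₁ swap01

inStrip-reflect-inside : {x M K : ℕ} → x ≤ M → K ≤ M → (a : Fin 3) →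
                         inStrip n x M a K ≡ inStrip n (M ∸ x) M (swap01 a) (M ∸ K)
inStrip-reflect-inside x≤M K≤M 0F = btw-reflect K≤M x≤M
inStrip-reflect-inside {x = x} {M} {K} x≤M K≤M 1F =
  trans (btw-reflect K≤M ≤-refl) (cong (λ lo → btw lo (M ∸ K) (M ∸ x)) (n∸n≡0 M))
inStrip-reflect-inside {n} {M = M} {K} x≤M K≤M 2F =
  trans (btw-below {hi = suc n} K≤M) (sym (btw-below {hi = suc n} (ℕ.m∸n≤m M K)))

inStrip-reflect-outside : {x M K : ℕ} → x ≤ M → M ≤ K → (a : Fin 3) →
                          inStrip n x M a K ≡ inStrip n (M ∸ x) M (swap01 a) K
inStrip-reflect-outside x≤M M≤K 0F = trans (btw-above (ℕ.≤-trans x≤M M≤K)) (sym (btw-above M≤K))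
inStrip-reflect-outside {x = x} {M} x≤M M≤K 1F =
  trans (btw-above M≤K) (sym (btw-above (ℕ.≤-trans (ℕ.m∸n≤m M x) M≤K)))
inStrip-reflect-outside x≤M M≤K 2F = refl

inStrip-reflectBelow : (m i k : Fin n) → toℕ i < toℕ m → (a : Fin 3) →
  inStrip n (column i) (column m) a (column k) ≡
  inStrip n (column (reflectBelow m i)) (column (reflectBelow m m)) (swap01 a) (column (reflectBelow m k))
inStrip-reflectBelow {n} m i k i<m a = trans (by-cases (toℕ k <? toℕ m))
  (sym (inStrip-cong (swap01 a) (column-reflectBelow m i i<m) (cong column (reflectBelow-self m)) refl))
  where
  i≤m : column i ≤ column m
  i≤m = s≤s (ℕ.<⇒≤ i<m)
  by-cases : Dec (toℕ k < toℕ m) →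
             inStrip n (column i) (column m) a (column k) ≡
             inStrip n (column m ∸ column i) (column m) (swap01 a) (column (reflectBelow m k))
  by-cases (yes k<m) = trans (inStrip-reflect-inside i≤m (s≤s (ℕ.<⇒≤ k<m)) a)
                             (inStrip-cong (swap01 a) refl refl (sym (column-reflectBelow m k k<m)))
  by-cases (no k≮m)  = trans (inStrip-reflect-outside i≤m (s≤s (≮⇒≥ k≮m)) a)
                             (inStrip-cong (swap01 a) refl refl (cong column (sym (reflectBelow-fixed m k k≮m))))

reversePrefix : Fin n → Vec (Fin n) n → Vec (Fin n) n
reversePrefix m = relabel id (reflectBelow m)

reversePrefix-IsPerm : (m : Fin n) (π : Vec (Fin n) n) → IsPerm π → IsPerm (reversePrefix m π)
reversePrefix-IsPerm m =
  relabel-IsPerm {τ = id} {reflectBelow m} (λ eq → eq) (involutive⇒injective (reflectBelow-involutive m))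

reversePrefix-involutive : (m : Fin n) (π : Vec (Fin n) n) → reversePrefix m (reversePrefix m π) ≡ π
reversePrefix-involutive m = relabel-involutive {τ = id} {reflectBelow m} (λ _ → refl) (reflectBelow-involutive m)

occ-reversePrefix : (R : MeshSet) (π : Vec (Fin n) n) (m : Fin n) →
                    (∀ i j → j ≢ m → isOcc R (reversePrefix m π) i j ≡ false) →
                    (∀ i j → j ≢ m → isOcc (map swapColumns01 R) π i j ≡ false) →
                    occ R (reversePrefix m π) ≡ occ (map swapColumns01 R) π
occ-reversePrefix {n} R π m absent′ absent =
  occ-transport {R = R} {map swapColumns01 R} {π′} {π} σ×σ σ×σ σ×σ-involutive σ×σ-involutive occurrence
  where
  π′ : Vec (Fin n) n
  π′ = reversePrefix m π
  σ : Fin n → Fin n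
  σ = reflectBelow m
  σ×σ : Fin n × Fin n → Fin n × Fin n
  σ×σ = Product.map σ σ
  σ×σ-involutive : ∀ p → σ×σ (σ×σ p) ≡ p
  σ×σ-involutive (i , j) = cong₂ _,_ (reflectBelow-involutive m i) (reflectBelow-involutive m j)
  val′ : ∀ k → val π′ k ≡ val π (σ k)
  val′ k = cong column (lookup-relabel id σ π k)
  σ-fixes-only-m : ∀ {j} → σ j ≡ m → j ≡ m
  σ-fixes-only-m {j} σj≡m = trans (sym (reflectBelow-involutive m j)) (trans (cong σ σj≡m) (reflectBelow-self m))
  occurrence : ∀ p → uncurry (isOcc R π′) p ≡ uncurry (isOcc (map swapColumns01 R) π) (σ×σ p)
  occurrence (i , j) with j ≟ m
  ... | no  j≢m  = trans (absent′ i j j≢m) (sym (absent (σ i) (σ j) (j≢m ∘ σ-fixes-only-m)))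
  ... | yes refl = isOcc-transport R swapColumns01 σ σ (reflectBelow-involutive m) π′ i m π (σ i) (σ m)
                                   (cong₂ _∧_ (column<ᵇ-reflectBelow m i) (cong₂ _<ᵇ_ (val′ i) (val′ m))) boxes
    where
    boxes : T (ascent π′ i m) → ∀ ab k → inBox π′ i m ab k ≡ inBox π (σ i) (σ m) (swapColumns01 ab) (σ k)
    boxes asc (a , b) k = cong₂ _∧_ (inStrip-reflectBelow m i k (s<s⁻¹ (ascent⇒column< π′ i m asc)) a)
                                    (inStrip-cong b (val′ i) (val′ m) (val′ k))

-- Shaded rows and columns that force an occurrence's position

Blocked : MeshSet → Vec (Fin n) n → Fin n → Fin n → Set
Blocked R π i j = ∃ λ ab → ab ∈ R × ∃ λ k → T (inBox π i j ab k)

isOcc-blocked : (R : MeshSet) (π : Vec (Fin n) n) (i j : Fin n) →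
                (T (ascent π i j) → Blocked R π i j) → isOcc R π i j ≡ false
isOcc-blocked {n} R π i j blocked = T-injective occurs⇒⊥ (λ ())
  where
  occurs⇒⊥ : T (isOcc R π i j) → T false
  occurs⇒⊥ occurs
    with asc , empty ← Equivalence.to T-∧ (subst T (isOcc≡ascent∧boxesEmpty R π i j) occurs)
    with ab , ab∈R , k , inside ← blocked asc
    = ⊥-elim (T-not⇒¬T (All.lookup (all⁺ _ R empty) ab∈R) (any⁺ _ (lose (∈-allFin k) inside)))

T-btw : {lo K hi : ℕ} → lo < K → K < hi → T (btw lo K hi)
T-btw lo<K K<hi = Equivalence.from T-∧ (<⇒<ᵇ lo<K , <⇒<ᵇ K<hi)

btw⇒< : {lo K hi : ℕ} → T (btw lo K hi) → lo < K × K < hi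
btw⇒< = Product.map (<ᵇ⇒< _ _) (<ᵇ⇒< _ _) ∘ Equivalence.to T-∧

inSomeStrip : {lo hi K : ℕ} → lo < hi → 0 < K → K < suc n → K ≢ lo → K ≢ hi →
              ∃ λ a → T (inStrip n lo hi a K)
inSomeStrip {lo = lo} {hi} {K} lo<hi 0<K K<N K≢lo K≢hi with <-cmp K lo
... | tri< K<lo _ _ = 0F , T-btw 0<K K<lo
... | tri≈ _ K≡lo _ = contradiction K≡lo K≢lo
... | tri> _ _ lo<K with <-cmp K hi
...   | tri< K<hi _ _ = 1F , T-btw lo<K K<hi
...   | tri≈ _ K≡hi _ = contradiction K≡hi K≢hi
...   | tri> _ _ hi<K = 2F , T-btw hi<K K<N

inStrip⇒≢ : {lo hi K : ℕ} (a : Fin 3) → lo < hi → T (inStrip n lo hi a K) → K ≢ lo × K ≢ hi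
inStrip⇒≢ 0F lo<hi inside with _ , K<lo ← btw⇒< inside = <⇒≢ K<lo , <⇒≢ (ℕ.<-trans K<lo lo<hi)
inStrip⇒≢ 1F lo<hi inside with lo<K , K<hi ← btw⇒< inside = >⇒≢ lo<K , <⇒≢ K<hi
inStrip⇒≢ {n} 2F lo<hi inside with hi<K , _ ← btw⇒< {hi = suc n} inside =
  >⇒≢ (ℕ.<-trans lo<hi hi<K) , >⇒≢ hi<K

fullRow-blocked : {R : MeshSet} (π : Vec (Fin n) n) (i j : Fin n) (b : Fin 3) (k : Fin n) →
                  (∀ a → (a , b) ∈ R) → T (inStrip n (val π i) (val π j) b (val π k)) →
                  T (ascent π i j) → Blocked R π i j
fullRow-blocked π i j b k shaded inRow asc
  with vk≢vi , vk≢vj ← inStrip⇒≢ b (ascent⇒val< π i j asc) inRow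
  with a , inColumn ← inSomeStrip (ascent⇒column< π i j asc) (s≤s z≤n) (column<suc k)
                                  (vk≢vi ∘ cong (val π) ∘ column-injective) (vk≢vj ∘ cong (val π) ∘ column-injective)
  = (a , b) , shaded a , k , Equivalence.from T-∧ (inColumn , inRow)

fullColumn-blocked : {R : MeshSet} (π : Vec (Fin n) n) (i j : Fin n) → IsPerm π → (a : Fin 3) (k : Fin n) →
                     (∀ b → (a , b) ∈ R) → T (inStrip n (column i) (column j) a (column k)) →
                     T (ascent π i j) → Blocked R π i j
fullColumn-blocked π i j inj a k shaded inColumn asc
  with ck≢ci , ck≢cj ← inStrip⇒≢ a (ascent⇒column< π i j asc) inColumn
  with b , inRow ← inSomeStrip (ascent⇒val< π i j asc) (s≤s z≤n) (column<suc (lookup π k))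
                               (ck≢ci ∘ cong column ∘ inj ∘ column-injective)
                               (ck≢cj ∘ cong column ∘ inj ∘ column-injective)
  = (a , b) , shaded b , k , Equivalence.from T-∧ (inColumn , inRow)

inTopStrip : (lo : ℕ) (x : Fin (suc n)) → x ≢ fromℕ n →
             T (inStrip (suc n) lo (column x) 2F (column (fromℕ n)))
inTopStrip {n} lo x x≢max rewrite toℕ-fromℕ n = T-btw (s≤s x<n) (s≤s (s≤s ≤-refl))
  where
  x<n : toℕ x < n
  x<n = ℕ.≤∧≢⇒< (s≤s⁻¹ (toℕ<n x)) (λ x≡n → x≢max (toℕ-injective (trans x≡n (sym (toℕ-fromℕ n)))))

TopRowShaded : MeshSet → Set
TopRowShaded R = ∀ a → (a , 2F) ∈ R

RightColumnShaded : MeshSet → Set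
RightColumnShaded R = ∀ b → (2F , b) ∈ R

TopRowShaded-swapColumns01 : {R : MeshSet} → TopRowShaded R → TopRowShaded (map swapColumns01 R)
TopRowShaded-swapColumns01 shaded 0F = ∈-map⁺ swapColumns01 (shaded 1F)
TopRowShaded-swapColumns01 shaded 1F = ∈-map⁺ swapColumns01 (shaded 0F)
TopRowShaded-swapColumns01 shaded 2F = ∈-map⁺ swapColumns01 (shaded 2F)

RightColumnShaded-swapColumns01 : {R : MeshSet} → RightColumnShaded R → RightColumnShaded (map swapColumns01 R)
RightColumnShaded-swapColumns01 shaded = ∈-map⁺ swapColumns01 ∘ shaded

maxPosition : Vec (Fin (suc n)) (suc n) → Fin (suc n)
maxPosition {n} π = preimage π (fromℕ n)

maxPosition-reversePrefix : (π : Vec (Fin (suc n)) (suc n)) → IsPerm π →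
                            maxPosition (reversePrefix (maxPosition π) π) ≡ maxPosition π
maxPosition-reversePrefix {n} π inj =
  trans (cong (preimage π′) (sym max-fixed)) (preimage-lookup π′ (reversePrefix-IsPerm top π inj) top)
  where
  top : Fin (suc n)
  top = maxPosition π
  π′ : Vec (Fin (suc n)) (suc n)
  π′ = reversePrefix top π
  max-fixed : lookup π′ top ≡ fromℕ n
  max-fixed = trans (lookup-relabel id (reflectBelow top) π top)
                    (trans (cong (lookup π) (reflectBelow-self top)) (lookup-preimage π inj (fromℕ n)))

topRow-forces-max : {R : MeshSet} → TopRowShaded R → (π : Vec (Fin (suc n)) (suc n)) → IsPerm π →
                    (i j : Fin (suc n)) → j ≢ maxPosition π → isOcc R π i j ≡ false
topRow-forces-max {n} shaded π inj i j j≢max =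
  isOcc-blocked _ π i j (fullRow-blocked π i j 2F (maxPosition π) shaded top)
  where
  πj≢max : lookup π j ≢ fromℕ n
  πj≢max πj≡max = j≢max (trans (sym (preimage-lookup π inj j)) (cong (preimage π) πj≡max))
  top : T (inStrip (suc n) (val π i) (val π j) 2F (val π (maxPosition π)))
  top = subst (λ v → T (inStrip (suc n) (val π i) (val π j) 2F (column v)))
              (sym (lookup-preimage π inj (fromℕ n))) (inTopStrip (val π i) (lookup π j) πj≢max)

rightColumn-forces-last : {R : MeshSet} → RightColumnShaded R → (π : Vec (Fin (suc n)) (suc n)) → IsPerm π →
                          (i j : Fin (suc n)) → j ≢ fromℕ n → isOcc R π i j ≡ false
rightColumn-forces-last {n} shaded π inj i j j≢last =
  isOcc-blocked _ π i j (fullColumn-blocked π i j inj 2F (fromℕ n) shaded (inTopStrip (column i) j j≢last))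

occurrenceInvolution₀ : {R R′ : MeshSet} → OccurrenceInvolution 0 R R′
occurrenceInvolution₀ = record
  { φ = id ; φ-IsPerm = λ _ inj → inj ; φ-involutive = λ _ _ → refl ; occ-φ = λ _ _ → refl }

topRow-involution : {R : MeshSet} → TopRowShaded R → ∀ n → OccurrenceInvolution n R (map swapColumns01 R)
topRow-involution shaded zero = occurrenceInvolution₀
topRow-involution {R} shaded (suc n) = record
  { φ            = λ π → reversePrefix (maxPosition π) π
  ; φ-IsPerm     = λ π → reversePrefix-IsPerm (maxPosition π) π
  ; φ-involutive = λ π inj → trans (cong (λ m → reversePrefix m (reversePrefix (maxPosition π) π))
                                         (maxPosition-reversePrefix π inj))
                                   (reversePrefix-involutive (maxPosition π) π)
  ; occ-φ        = λ π inj → occ-reversePrefix R π (maxPosition π)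
      (λ i j j≢m → topRow-forces-max shaded (reversePrefix (maxPosition π) π)
                                     (reversePrefix-IsPerm (maxPosition π) π inj) i j
                                     (j≢m ∘ flip trans (maxPosition-reversePrefix π inj)))
      (topRow-forces-max (TopRowShaded-swapColumns01 shaded) π inj)
  }

rightColumn-involution : {R : MeshSet} → RightColumnShaded R → ∀ n → OccurrenceInvolution n R (map swapColumns01 R)
rightColumn-involution shaded zero = occurrenceInvolution₀
rightColumn-involution {R} shaded (suc n) = record
  { φ            = reversePrefix (fromℕ n)
  ; φ-IsPerm     = reversePrefix-IsPerm (fromℕ n)
  ; φ-involutive = λ π _ → reversePrefix-involutive (fromℕ n) π
  ; occ-φ        = λ π inj → occ-reversePrefix R π (fromℕ n)
      (rightColumn-forces-last shaded (reversePrefix (fromℕ n) π) (reversePrefix-IsPerm (fromℕ n) π inj))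
      (rightColumn-forces-last (RightColumnShaded-swapColumns01 shaded) π inj)
  }

record Equidistributed (R R′ : MeshSet) : Set where
  constructor equidistributed
  field s≡ : ∀ n k → s n k R ≡ s n k R′
open Equidistributed

infixr 5 _⨾_
_⨾_ : {R₁ R₂ R₃ : MeshSet} → Equidistributed R₁ R₂ → Equidistributed R₂ R₃ → Equidistributed R₁ R₃
R₁~R₂ ⨾ R₂~R₃ = equidistributed λ n k → trans (s≡ R₁~R₂ n k) (s≡ R₂~R₃ n k)

sameBoxes-equidistributed : {R R′ : MeshSet} → R ⊆ R′ → R′ ⊆ R → Equidistributed R R′
sameBoxes-equidistributed {R} {R′} R⊆R′ R′⊆R =
  equidistributed λ n k → count-cong _ _ (Sn n) (λ {π} _ → cong (_≡ᵇ k) (begin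
    occ R π                                  ≡⟨ occ≡count-pairs R π ⟩
    count (uncurry (isOcc R π)) (pairs n)    ≡⟨ count-cong _ _ (pairs n) (λ {(i , j)} _ → sameOcc π i j) ⟩
    count (uncurry (isOcc R′ π)) (pairs n)   ≡⟨ sym (occ≡count-pairs R′ π) ⟩
    occ R′ π                                 ∎))
  where
  open ≡-Reasoning
  sameOcc : (π : Vec (Fin n) n) (i j : Fin n) → isOcc R π i j ≡ isOcc R′ π i j
  sameOcc π i j = begin
    isOcc R π i j                        ≡⟨ isOcc≡ascent∧boxesEmpty R π i j ⟩
    ascent π i j ∧ boxesEmpty R π i j    ≡⟨ cong (ascent π i j ∧_) (T-injective (all-anti-mono _ R′⊆R)
                                                                                 (all-anti-mono _ R⊆R′)) ⟩
    ascent π i j ∧ boxesEmpty R′ π i j   ≡⟨ sym (isOcc≡ascent∧boxesEmpty R′ π i j) ⟩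
    isOcc R′ π i j                       ∎

rotate-equidistributed : (R : MeshSet) → Equidistributed R (map rotateBox R)
rotate-equidistributed R = equidistributed λ n → s-cong {n} {R} {map rotateBox R} record
  { φ            = rotate
  ; φ-IsPerm     = relabel-IsPerm {τ = opposite} {opposite} opposite-injective opposite-injective
  ; φ-involutive = λ π _ → relabel-involutive {τ = opposite} {opposite} opposite-involutive opposite-involutive π
  ; occ-φ        = λ π _ → occ-rotate R π
  }
  where
  opposite-injective : Injective _≡_ _≡_ (opposite {n})
  opposite-injective = involutive⇒injective opposite-involutive

inverse-equidistributed : (R : MeshSet) → Equidistributed R (map swap R)
inverse-equidistributed R = equidistributed λ n → s-cong {n} {R} {map swap R} record
  { φ = inverse ; φ-IsPerm = inverse-IsPerm ; φ-involutive = inverse-involutive ; occ-φ = occ-inverse R }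

topRow-equidistributed : {R : MeshSet} → TopRowShaded R → Equidistributed R (map swapColumns01 R)
topRow-equidistributed shaded = equidistributed λ n → s-cong (topRow-involution shaded n)

rightColumn-equidistributed : {R : MeshSet} → RightColumnShaded R → Equidistributed R (map swapColumns01 R)
rightColumn-equidistributed shaded = equidistributed λ n → s-cong (rightColumn-involution shaded n)

via : {R R₁ R′ : MeshSet} → Equidistributed R R₁ → {True ((R₁ ⊆? R′) ×-dec (R′ ⊆? R₁))} → Equidistributed R R′
via {R₁ = R₁} {R′} R~R₁ {same} =
  R~R₁ ⨾ uncurry sameBoxes-equidistributed (toWitness {a? = (R₁ ⊆? R′) ×-dec (R′ ⊆? R₁)} same)

topRowShaded? : (R : MeshSet) → Dec (TopRowShaded R)
topRowShaded? R = Fin.all? (λ a → (a , 2F) ∈? R)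

rightColumnShaded? : (R : MeshSet) → Dec (RightColumnShaded R)
rightColumnShaded? R = Fin.all? (λ b → (2F , b) ∈? R)

pattern 10F = Fin.suc 9F
pattern 11F = Fin.suc 10F
pattern 12F = Fin.suc 11F
pattern 13F = Fin.suc 12F
pattern 14F = Fin.suc 13F
pattern 15F = Fin.suc 14F

equidistributed-with-8 : (i : Fin 16) → Equidistributed (pat i) (pat 8F)
equidistributed-with-8 = to8
  where
  p6 : Equidistributed (pat 6F) (pat 8F)
  p6 = via (rightColumn-equidistributed (from-yes (rightColumnShaded? (pat 6F))))
  p4 : Equidistributed (pat 4F) (pat 8F)
  p4 = via (inverse-equidistributed (pat 4F)) ⨾ p6
  p0 : Equidistributed (pat 0F) (pat 8F)
  p0 = via (topRow-equidistributed (from-yes (topRowShaded? (pat 0F)))) ⨾ p4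
  p2 : Equidistributed (pat 2F) (pat 8F)
  p2 = via (inverse-equidistributed (pat 2F)) ⨾ p0
  p14 : Equidistributed (pat 14F) (pat 8F)
  p14 = via (rightColumn-equidistributed (from-yes (rightColumnShaded? (pat 14F)))) ⨾ p2
  p12 : Equidistributed (pat 12F) (pat 8F)
  p12 = via (inverse-equidistributed (pat 12F)) ⨾ p14
  p10 : Equidistributed (pat 10F) (pat 8F)
  p10 = via (inverse-equidistributed (pat 10F))
  to8 : (i : Fin 16) → Equidistributed (pat i) (pat 8F)
  to8 0F  = p0
  to8 1F  = via (rotate-equidistributed (pat 1F)) ⨾ p2
  to8 2F  = p2
  to8 3F  = via (rotate-equidistributed (pat 3F)) ⨾ p0
  to8 4F  = p4
  to8 5F  = via (rotate-equidistributed (pat 5F)) ⨾ p6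
  to8 6F  = p6
  to8 7F  = via (rotate-equidistributed (pat 7F)) ⨾ p4
  to8 8F  = equidistributed λ _ _ → refl
  to8 9F  = via (rotate-equidistributed (pat 9F))
  to8 10F = p10
  to8 11F = via (rotate-equidistributed (pat 11F)) ⨾ p10
  to8 12F = p12
  to8 13F = via (rotate-equidistributed (pat 13F)) ⨾ p14
  to8 14F = p14
  to8 15F = via (rotate-equidistributed (pat 15F)) ⨾ p12

-- Avoiders of pattern 8

any-none : (p : A → Bool) (xs : List A) → (∀ x → p x ≡ false) → any p xs ≡ false
any-none p []       _    = refl
any-none p (x ∷ xs) none rewrite none x = any-none p xs none

not-<ᵇ : {a b : ℕ} → a ≢ b → not (a <ᵇ b) ≡ (b <ᵇ a)
not-<ᵇ {a} {b} a≢b with <-cmp a b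
... | tri< a<b _ _ = trans (cong not (dec-true (a <? b) a<b)) (sym (dec-false (b <? a) (<-asym a<b)))
... | tri≈ _ a≡b _ = contradiction a≡b a≢b
... | tri> _ _ b<a = trans (cong not (dec-false (a <? b) (<-asym b<a))) (sym (dec-true (b <? a) b<a))

reverse : Vec (Fin n) n → Vec (Fin n) n
reverse = relabel id opposite

reverse-IsPerm : (π : Vec (Fin n) n) → IsPerm π → IsPerm (reverse π)
reverse-IsPerm = relabel-IsPerm {τ = id} {opposite} (λ eq → eq) (involutive⇒injective opposite-involutive)

reverse-involutive : (π : Vec (Fin n) n) → reverse (reverse π) ≡ π
reverse-involutive = relabel-involutive {τ = id} {opposite} (λ _ → refl) opposite-involutive

endsLower : Vec (Fin (suc n)) (suc n) → Bool
endsLower {n} π = val π (fromℕ n) <ᵇ val π Fin.zero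

module _ {n : ℕ} (π : Vec (Fin (2 + n)) (2 + n)) (inj : IsPerm π) where

  private
    first last : Fin (2 + n)
    first = Fin.zero
    last  = fromℕ (suc n)

  ends-distinct : val π last ≢ val π first
  ends-distinct eq with inj (column-injective eq)
  ... | ()

  pat8-absent : val π last < val π first → occ (pat 8F) π ≡ 0
  pat8-absent lower = trans (occ≡count-pairs (pat 8F) π) (count-none _ (pairs (2 + n)) (λ {(i , j)} _ → absent i j))
    where
    blocked : (i : Fin (2 + n)) → T (ascent π i last) → Blocked (pat 8F) π i last
    blocked Fin.zero    asc = ⊥-elim (<-asym lower (ascent⇒val< π first last asc))
    blocked (Fin.suc i) _   = (0F , 2F) , here refl , first ,
      Equivalence.from T-∧ ( T-btw {0} {1} {column (Fin.suc i)} (s≤s z≤n) (s≤s (s≤s z≤n))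
                           , T-btw {val π last} {val π first} {3 + n} lower (column<suc (lookup π first)))
    absent : (i j : Fin (2 + n)) → isOcc (pat 8F) π i j ≡ false
    absent i j with j ≟ last
    ... | no  j≢last = rightColumn-forces-last (from-yes (rightColumnShaded? (pat 8F))) π inj i j j≢last
    ... | yes refl   = isOcc-blocked (pat 8F) π i last (blocked i)

  pat8-present : val π first < val π last → occ (pat 8F) π ≢ 0
  pat8-present higher occ≡0 = count-≢0 (uncurry (isOcc (pat 8F) π)) (∈-pairs (first , last)) first-last
                                       (trans (sym (occ≡count-pairs (pat 8F) π)) occ≡0)
    where
    column≤last : (k : Fin (2 + n)) → column k ≤ column last
    column≤last k = s≤s (subst (toℕ k ≤_) (sym (toℕ-fromℕ (suc n))) (Fin.toℕ≤pred[n] k))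
    leftEmpty : ∀ b → T (not (any (inBox π first last (0F , b)) (allFin (2 + n))))
    leftEmpty b = Equivalence.from T-not-≡ (any-none _ (allFin (2 + n)) (λ _ → refl))
    rightEmpty : ∀ b → T (not (any (inBox π first last (2F , b)) (allFin (2 + n))))
    rightEmpty b = Equivalence.from T-not-≡ (any-none _ (allFin (2 + n)) λ k →
      cong (λ c → (c ∧ (column k <ᵇ 3 + n)) ∧ inStrip (2 + n) (val π first) (val π last) b (val π k))
           (dec-false (column last <? column k) (≤⇒≯ (column≤last k))))
    first-last : T (isOcc (pat 8F) π first last)
    first-last = subst T (sym (isOcc≡ascent∧boxesEmpty (pat 8F) π first last))
      (Equivalence.from (T-∧ {ascent π first last})
        ( Equivalence.from (T-∧ {column first <ᵇ column last}) (_ , <⇒<ᵇ higher)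
        , all⁻ (λ ab → not (any (inBox π first last ab) (allFin (2 + n)))) {xs = pat 8F}
               (leftEmpty 2F ∷ rightEmpty 2F ∷ leftEmpty 1F ∷ rightEmpty 1F ∷ rightEmpty 0F ∷ [])))

  avoids-pat8 : (occ (pat 8F) π ≡ᵇ 0) ≡ endsLower π
  avoids-pat8 with val π last <? val π first
  ... | yes lower  = trans (cong (_≡ᵇ 0) (pat8-absent lower)) (sym (dec-true (_ <? _) lower))
  ... | no  ¬lower = trans (dec-false (_ ℕ.≟ 0) (pat8-present higher)) (sym (dec-false (_ <? _) ¬lower))
    where
    higher : val π first < val π last
    higher = ℕ.≤∧≢⇒< (≮⇒≥ ¬lower) (ends-distinct ∘ sym)

  not-endsLower : not (endsLower π) ≡ endsLower (reverse π)
  not-endsLower = trans (not-<ᵇ ends-distinct) (sym (cong (_<ᵇ val π last) ends-swapped))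
    where
    ends-swapped : val (reverse π) last ≡ val π first
    ends-swapped = cong column (trans (lookup-relabel id opposite π last)
                                      (cong (lookup π) (opposite-involutive first)))

pat8-avoiders : (n : ℕ) → 2 ≤ n → s n 0 (pat 8F) ≡ n ! / 2
pat8-avoiders 1 (s≤s ())
pat8-avoiders (suc (suc n)) _ = begin
  s N 0 (pat 8F)                  ≡⟨ count-cong _ endsLower (Sn N) (λ {π} π∈ → avoids-pat8 π (∈-Sn⇒IsPerm π∈)) ⟩
  half                               ≡⟨ sym (m*n/n≡m half 2) ⟩
  half * 2 / 2                       ≡⟨ cong (_/ 2) twice ⟩
  N ! / 2                         ∎
  where
  open ≡-Reasoning
  N : ℕ
  N = suc (suc n)
  half : ℕ
  half = count endsLower (Sn N)
  endsHigher≡endsLower : count (not ∘ endsLower) (Sn N) ≡ half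
  endsHigher≡endsLower = trans (count-cong _ _ (Sn N) (λ {π} π∈ → not-endsLower π (∈-Sn⇒IsPerm π∈)))
                               (count-Sn-∘-involution {N} reverse reverse-IsPerm (λ π _ → reverse-involutive π) endsLower)
  twice : half * 2 ≡ N !
  twice = begin
    half * 2                               ≡⟨ ℕ.*-comm half 2 ⟩
    half + (half + 0)                         ≡⟨ cong (half +_) (trans (ℕ.+-identityʳ half) (sym endsHigher≡endsLower)) ⟩
    half + count (not ∘ endsLower) (Sn N)  ≡⟨ count-complement endsLower (Sn N) ⟩
    length (Sn N)                       ≡⟨ length-Sn {N} ⟩
    N !                                 ∎

theorem3p12 : ((i j : Fin 16) (n k : ℕ) → s n k (pat i) ≡ s n k (pat j))
              × ((i : Fin 16) (n : ℕ) → 2 ≤ n → s n 0 (pat i) ≡ (n !) / 2)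
theorem3p12 = (λ i j n k → trans (s≡ (equidistributed-with-8 i) n k) (sym (s≡ (equidistributed-with-8 j) n k)))
            , (λ i n 2≤n → trans (s≡ (equidistributed-with-8 i) n 0) (pat8-avoiders n 2≤n))
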